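{- Let $r$ be a set of rank conditions and $1\le p\le N$. There are unique integers $i,j$ with $0\le i\le j+1\le n+1$ such that $r_{n,j+1}+r_{i-1,j}-r_{i-1,j+1}<p\le r_{n,j+1}+r_{ij}-r_{i,j+1}$, and for these we have $z(r)(p)=p-r_{n,j+1}+r_{i,j+1}+r_{i-1,0}-r_{i-1,j}$.
   Context: Rank conditions: for $n\ge1$, a family $r=\{r_{ij}\}_{0\le i\le j\le n}$ of non-negative integers with $r_{ij}\le\min(r_{i,j-1},r_{i+1,j})$ for $i<j$ and $r_{ij}+r_{i-1,j+1}\ge r_{i-1,j}+r_{i,j+1}$ for $0<i\le j<n$. Dimension vector $e_i=r_{ii}$; extend by $r_{ij}=e_j+\dots+e_i$ for $j\le i$ and $r_{ij}=0$ if $i<0$ or $j>n$; $N=r_{n0}=e_0+\dots+e_n$. Permutations: $S_k$ on $\{1,\dots,k\}$, embedded in $S_{k+1}$ by fixing larger integers; $(uv)(p)=u(v(p))$. For $0\le i<n$, $0<j\le n$, $W_{ij}\in S_{r_{i+1,j-1}}$: $W_{ij}(p)=p+r_{i,j-1}-r_{ij}$ if $r_{ij}<p\le r_{i+1,j}$; $=p-r_{i+1,j}+r_{ij}$ if $r_{i+1,j}<p\le r_{i+1,j}+r_{i,j-1}-r_{ij}$; $=p$ otherwise. The conjugate Zelevinsky permutation is $z(r)=\prod_{j=1}^n\prod_{i=0}^{n-1}W_{ij}=(W_{01}W_{11}\cdots W_{n-1,1})(W_{02}\cdots W_{n-1,2})\cdots(W_{0n}\cdots W_{n-1,n})\in S_N$.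 -}

module Defs where

open import Data.Nat as ℕ using (ℕ; zero; suc; _∸_)
open import Data.Integer as ℤ using (ℤ; +_; -[1+_]; 0ℤ; 1ℤ)
open import Data.List using (List; []; _∷_; map; upTo; concatMap; foldr)
open import Data.Nat.ListAction using (sum)
open import Data.Product using (_×_; _,_)
open import Data.Bool using (if_then_else_; _∧_)
open import Relation.Nullary.Decidable using (⌊_⌋)
open import Function using (_∘_; id)

-- A family r_{ij}, 0 ≤ i ≤ j ≤ n, is given as a function ℕ → ℕ → ℕ;
-- only its values on 0 ≤ i ≤ j ≤ n are ever used.
RankConditions : ℕ → (ℕ → ℕ → ℕ) → Set
RankConditions n r =
  (∀ i j → i ℕ.< j → j ℕ.≤ n →
     (r i j ℕ.≤ r i (j ∸ 1)) × (r i j ℕ.≤ r (suc i) j)) ×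
  (∀ i j → 0 ℕ.< i → i ℕ.≤ j → j ℕ.< n →
     r (i ∸ 1) j ℕ.+ r i (suc j) ℕ.≤ r i j ℕ.+ r (i ∸ 1) (suc j))

dimVec : ℕ → (ℕ → ℕ → ℕ) → ℕ → ℕ
dimVec n r k = if ⌊ k ℕ.≤? n ⌋ then r k k else 0

sumE : ℕ → (ℕ → ℕ → ℕ) → ℕ → ℕ → ℕ
sumE n r a b = sum (map (λ t → dimVec n r (a ℕ.+ t)) (upTo (suc (b ∸ a))))

-- the extended family r_{ij} for all integers i, j (values in ℤ):
--   r_{ij} = 0 if i < 0 or j > n; r_{ij} as given if 0 ≤ i ≤ j ≤ n;
--   r_{ij} = e_j + ... + e_i if j ≤ i (with e_k = 0 for k < 0 or k > n).
rx : ℕ → (ℕ → ℕ → ℕ) → ℤ → ℤ → ℤ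
rx n r -[1+ _ ] j = 0ℤ
rx n r (+ i) -[1+ _ ] = + sumE n r 0 i
rx n r (+ i) (+ j) =
  if ⌊ j ℕ.≤? n ⌋
  then (if ⌊ i ℕ.≤? j ⌋ then + r i j else + sumE n r j i)
  else 0ℤ

bigN : ℕ → (ℕ → ℕ → ℕ) → ℤ
bigN n r = rx n r (+ n) (+ 0)

W : ℕ → (ℕ → ℕ → ℕ) → ℕ → ℕ → ℤ → ℤ
W n r i j p =
  if ⌊ a ℤ.<? p ⌋ ∧ ⌊ p ℤ.≤? b ⌋ then p ℤ.+ c ℤ.- a
  else if ⌊ b ℤ.<? p ⌋ ∧ ⌊ p ℤ.≤? b ℤ.+ c ℤ.- a ⌋ then p ℤ.- b ℤ.+ a
  else p
  where
  a = rx n r (+ i) (+ j)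
  b = rx n r (+ suc i) (+ j)
  c = rx n r (+ i) (+ (j ∸ 1))

zIndices : ℕ → List (ℕ × ℕ)
zIndices n = concatMap (λ j → map (λ i → (i , j)) (upTo n)) (map suc (upTo n))

-- conjugate Zelevinsky permutation z(r) = Π_j Π_i W_{ij}, with (uv)(p) = u(v(p))
zperm : ℕ → (ℕ → ℕ → ℕ) → ℤ → ℤ
zperm n r = foldr (λ { (i , j) f → W n r i j ∘ f }) id (zIndices n)

IJCond : ℕ → (ℕ → ℕ → ℕ) → ℤ → ℤ → ℤ → Set
IJCond n r p i j =
  (0ℤ ℤ.≤ i) × (i ℤ.≤ j ℤ.+ 1ℤ) × (j ℤ.+ 1ℤ ℤ.≤ + n ℤ.+ 1ℤ) ×
  (R (+ n) (j ℤ.+ 1ℤ) ℤ.+ R (i ℤ.- 1ℤ) j ℤ.- R (i ℤ.- 1ℤ) (j ℤ.+ 1ℤ) ℤ.< p) ×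
  (p ℤ.≤ R (+ n) (j ℤ.+ 1ℤ) ℤ.+ R i j ℤ.- R i (j ℤ.+ 1ℤ))
  where R = rx n r

module Submission where

-- z(r) is the composite of the column blocks B_k = W_{0k} ⋯ W_{n-1,k}, applied for k = n, …, 1.
-- With α_t = r_{t-1,k} and gaps δ_t = r_{t-1,k-1} - r_{t-1,k}, the rank conditions make α and δ
-- increasing in t, and B_k then interleaves two families of intervals: it raises (α_t, α_{t+1}]
-- by δ_t and moves (r_{nk} + δ_t, r_{nk} + δ_{t+1}] down to start at α_{t+1} + δ_t.
-- The cut points L_{ij} = r_{n,j+1} + r_{i-1,j} - r_{i-1,j+1} increase in i, again by the rank
-- conditions, from r_{n,j+1} to r_{nj}, so the cells (L_{ij}, L_{i+1,j}] partition (0, N]: this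
-- gives existence and uniqueness of (i, j). A point p of cell (i, j) is fixed by the blocks
-- k > j + 1, moved to p - r_{n,j+1} + r_{i,j+1} by B_{j+1}, and raised by r_{i-1,k-1} - r_{i-1,k}
-- by each B_k with k ≤ j; these shifts telescope to the stated formula.

open import Data.Bool using (if_then_else_; _∧_)
open import Data.Empty using (⊥-elim)
open import Data.Integer as ℤ using (ℤ; +_; -[1+_]; 0ℤ; 1ℤ; _+_; _-_; -_)
open import Data.Integer.Properties
open import Data.Integer.Tactic.RingSolver using (solve-∀)
open import Data.List using (List; []; _∷_; _++_; map; upTo; applyUpTo; concat; foldr)
open import Data.List.Properties using (map-++; map-upTo; map-applyUpTo; upTo-∷ʳ; map-cong; foldr-++)
open import Data.Nat as ℕ using (ℕ; zero; suc; _∸_; z≤n; s≤s)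
import Data.Nat.Properties as ℕP
open import Data.Nat.ListAction using (sum)
open import Data.Nat.ListAction.Properties using (sum-++)
open import Data.Product using (Σ; _×_; _,_; proj₁; proj₂)
open import Data.Sum using (inj₁; inj₂)
open import Function using (_∘_; id)
open import Relation.Binary.Definitions using (tri<; tri≈; tri>)
open import Relation.Binary.PropositionalEquality
open import Relation.Nullary using (yes; no)
open import Relation.Nullary.Decidable using (⌊_⌋)

open import Defs

module Sequences where
  open import Data.Integer using (_≤_; _<_)

  <-via-difference : ∀ {i j} s → j - i ≡ s → 0ℤ < s → i < j
  <-via-difference {i} {j} s j-i≡s 0<s =
    subst₂ _<_ (+-identityʳ i) (i+[j-i]≡j i j) (+-monoʳ-< i (subst (0ℤ <_) (sym j-i≡s) 0<s))
    where
    i+[j-i]≡j : ∀ i j → i + (j - i) ≡ j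
    i+[j-i]≡j = solve-∀

  ≤-via-difference : ∀ {i j} s → j - i ≡ s → 0ℤ ≤ s → i ≤ j
  ≤-via-difference s j-i≡s 0≤s = 0≤i-j⇒j≤i (subst (0ℤ ≤_) (sym j-i≡s) 0≤s)

  i<j⇒0<j-i : ∀ {i j} → i < j → 0ℤ < j - i
  i<j⇒0<j-i {i} {j} i<j = subst₂ _<_ (+-inverseˡ i) (+-comm (- i) j) (+-monoʳ-< (- i) i<j)

  IncreasingBelow : (ℕ → ℤ) → ℕ → Set
  IncreasingBelow f B = ∀ t → t ℕ.< B → f t ≤ f (suc t)

  DecreasingBelow : (ℕ → ℤ) → ℕ → Set
  DecreasingBelow f B = ∀ t → t ℕ.< B → f (suc t) ≤ f t

  increasing⇒monotone : ∀ {f B} → IncreasingBelow f B → ∀ {a b} → a ℕ.≤ b → b ℕ.≤ B → f a ≤ f b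
  increasing⇒monotone {f} inc {a} a≤b = go (ℕP.≤⇒≤′ a≤b)
    where
    go : ∀ {b} → a ℕ.≤′ b → b ℕ.≤ _ → f a ≤ f b
    go ℕ.≤′-refl        _   = ≤-refl
    go (ℕ.≤′-step a≤′b) b<B = ≤-trans (go a≤′b (ℕP.<⇒≤ b<B)) (inc _ b<B)

  decreasing⇒antitone : ∀ {f B} → DecreasingBelow f B → ∀ {a b} → a ℕ.≤ b → b ℕ.≤ B → f b ≤ f a
  decreasing⇒antitone {f} dec {a} a≤b = go (ℕP.≤⇒≤′ a≤b)
    where
    go : ∀ {b} → a ℕ.≤′ b → b ℕ.≤ _ → f b ≤ f a
    go ℕ.≤′-refl        _   = ≤-refl
    go (ℕ.≤′-step a≤′b) b<B = ≤-trans (dec _ b<B) (go a≤′b (ℕP.<⇒≤ b<B))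

  upward-crossing : ∀ (f : ℕ → ℤ) {p} m → f 0 < p → p ≤ f m →
                    Σ ℕ λ t → t ℕ.< m × f t < p × p ≤ f (suc t)
  upward-crossing f zero    f0<p p≤fm = ⊥-elim (<⇒≱ f0<p p≤fm)
  upward-crossing f {p} (suc m) f0<p p≤fm with f m ℤ.<? p
  ... | yes fm<p = m , ℕP.≤-refl , fm<p , p≤fm
  ... | no  fm≮p with upward-crossing f m f0<p (≮⇒≥ fm≮p)
  ...   | t , t<m , crossing = t , ℕP.m≤n⇒m≤1+n t<m , crossing

  downward-crossing : ∀ (f : ℕ → ℤ) {p} m → f m < p → p ≤ f 0 →
                      Σ ℕ λ t → t ℕ.< m × f (suc t) < p × p ≤ f t
  downward-crossing f zero    fm<p p≤f0 = ⊥-elim (<⇒≱ fm<p p≤f0)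
  downward-crossing f {p} (suc m) fm<p p≤f0 with p ℤ.≤? f m
  ... | yes p≤fm = m , ℕP.≤-refl , fm<p , p≤fm
  ... | no  p≰fm with downward-crossing f m (≰⇒> p≰fm) p≤f0
  ...   | t , t<m , crossing = t , ℕP.m≤n⇒m≤1+n t<m , crossing

  upward-crossing-unique : ∀ {f B p s t} → IncreasingBelow f B → s ℕ.< B → t ℕ.< B →
                           f s < p → p ≤ f (suc s) → f t < p → p ≤ f (suc t) → s ≡ t
  upward-crossing-unique {s = s} {t} inc s<B t<B fs<p p≤fs′ ft<p p≤ft′ with ℕP.<-cmp s t
  ... | tri≈ _ s≡t _ = s≡t
  ... | tri< s<t _ _ = ⊥-elim (<⇒≱ ft<p (≤-trans p≤fs′ (increasing⇒monotone inc s<t (ℕP.<⇒≤ t<B))))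
  ... | tri> _ _ t<s = ⊥-elim (<⇒≱ fs<p (≤-trans p≤ft′ (increasing⇒monotone inc t<s (ℕP.<⇒≤ s<B))))

  downward-crossing-unique : ∀ {f B p s t} → DecreasingBelow f B → s ℕ.< B → t ℕ.< B →
                             f (suc s) < p → p ≤ f s → f (suc t) < p → p ≤ f t → s ≡ t
  downward-crossing-unique {s = s} {t} dec s<B t<B fs′<p p≤fs ft′<p p≤ft with ℕP.<-cmp s t
  ... | tri≈ _ s≡t _ = s≡t
  ... | tri< s<t _ _ = ⊥-elim (<⇒≱ fs′<p (≤-trans p≤ft (decreasing⇒antitone dec s<t (ℕP.<⇒≤ t<B))))
  ... | tri> _ _ t<s = ⊥-elim (<⇒≱ ft′<p (≤-trans p≤fs (decreasing⇒antitone dec t<s (ℕP.<⇒≤ s<B))))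

module Exchanges where
  open import Data.Integer using (_≤_; _<_; _<?_; _≤?_)
  open Sequences

  -- The permutation W_{ij} with a = r_{ij}, b = r_{i+1,j}, c = r_{i,j-1}: it swaps the adjacent
  -- intervals (a, b] and (b, b + c - a], preserving the order inside each.
  exchange : ℤ → ℤ → ℤ → ℤ → ℤ
  exchange a b c p =
    if ⌊ a <? p ⌋ ∧ ⌊ p ≤? b ⌋ then p + c - a
    else if ⌊ b <? p ⌋ ∧ ⌊ p ≤? b + c - a ⌋ then p - b + a
    else p

  exchange-lower : ∀ a b c {p} → a < p → p ≤ b → exchange a b c p ≡ p + c - a
  exchange-lower a b c {p} a<p p≤b with a <? p | p ≤? b
  ... | yes _   | yes _   = refl
  ... | no  a≮p | _       = ⊥-elim (a≮p a<p)
  ... | yes _   | no  p≰b = ⊥-elim (p≰b p≤b)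

  exchange-upper : ∀ a b c {p} → b < p → p ≤ b + c - a → exchange a b c p ≡ p - b + a
  exchange-upper a b c {p} b<p p≤ with a <? p | p ≤? b | b <? p | p ≤? b + c - a
  ... | _     | yes p≤b | _       | _       = ⊥-elim (<⇒≱ b<p p≤b)
  ... | _     | _       | no  b≮p | _       = ⊥-elim (b≮p b<p)
  ... | _     | _       | _       | no  p≰  = ⊥-elim (p≰ p≤)
  ... | yes _ | no _    | yes _   | yes _   = refl
  ... | no _  | no _    | yes _   | yes _   = refl

  exchange-below : ∀ a b c {p} → a ≤ b → p ≤ a → exchange a b c p ≡ p
  exchange-below a b c {p} a≤b p≤a with a <? p | b <? p
  ... | yes a<p | _       = ⊥-elim (<⇒≱ a<p p≤a)
  ... | _       | yes b<p = ⊥-elim (<⇒≱ b<p (≤-trans p≤a a≤b))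
  ... | no _    | no _    = refl

  exchange-above : ∀ a b c {p} → a ≤ c → b + c - a < p → exchange a b c p ≡ p
  exchange-above a b c {p} a≤c top<p with a <? p | p ≤? b | b <? p | p ≤? b + c - a
  ... | _     | yes p≤b | _     | _        = ⊥-elim (<⇒≱ (≤-<-trans b≤top top<p) p≤b)
    where
    b≤top : b ≤ b + c - a
    b≤top = ≤-via-difference (c - a) (b+c-a-b≡c-a b c a) (i≤j⇒0≤j-i a≤c)
      where
      b+c-a-b≡c-a : ∀ b c a → b + c - a - b ≡ c - a
      b+c-a-b≡c-a = solve-∀
  ... | _     | _       | _     | yes p≤top = ⊥-elim (<⇒≱ top<p p≤top)
  ... | yes _ | no _    | yes _ | no _     = refl
  ... | yes _ | no _    | no _  | no _     = refl
  ... | no _  | no _    | yes _ | no _     = refl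
  ... | no _  | no _    | no _  | no _     = refl

  exchanges : (α γ : ℕ → ℤ) → ℕ → ℕ → ℤ → ℤ
  exchanges α γ m zero    x = x
  exchanges α γ m (suc c) x = exchange (α (suc m)) (α (suc (suc m))) (γ (suc m)) (exchanges α γ (suc m) c x)

  module Block (n : ℕ) (α γ : ℕ → ℤ)
    (α-increasing : IncreasingBelow α (suc n))
    (gap-increasing : IncreasingBelow (λ t → γ t - α t) (suc n))
    (gap-zero : γ 0 - α 0 ≡ 0ℤ) where

    gap : ℕ → ℤ
    gap t = γ t - α t

    A : ℤ
    A = α (suc n)

    gap-nonneg : ∀ {t} → t ℕ.≤ suc n → 0ℤ ≤ gap t
    gap-nonneg {t} t≤ = subst (_≤ gap t) gap-zero (increasing⇒monotone gap-increasing z≤n t≤)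

    α≤γ : ∀ {t} → t ℕ.≤ suc n → α t ≤ γ t
    α≤γ = 0≤i-j⇒j≤i ∘ gap-nonneg

    A≤A+gap : ∀ {t} → t ℕ.≤ suc n → A ≤ A + gap t
    A≤A+gap {t} t≤ = ≤-via-difference (gap t) (A+d-A≡d A (gap t)) (gap-nonneg t≤)
      where
      A+d-A≡d : ∀ A d → A + d - A ≡ d
      A+d-A≡d = solve-∀

    record Invariant (m c : ℕ) : Set where
      field
        fixes-below  : ∀ x → x ≤ α (suc m) → exchanges α γ m c x ≡ x
        raises       : ∀ t x → m ℕ.< t → t ℕ.≤ n → α t < x → x ≤ α (suc t) →
                       exchanges α γ m c x ≡ x + gap t
        lowers-first : ∀ x → A < x → x ≤ A + gap (suc m) → exchanges α γ m c x ≡ x - A + α (suc m)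
        lowers       : ∀ t x → m ℕ.< t → t ℕ.≤ n → A + gap t < x → x ≤ A + gap (suc t) →
                       exchanges α γ m c x ≡ x - A + α (suc t)
        fixes-above  : ∀ x → A + gap (suc n) < x → exchanges α γ m c x ≡ x

    invariant-start : Invariant n zero
    invariant-start = record
      { fixes-below  = λ _ _ → refl
      ; raises       = λ _ _ n<t t≤n _ _ → ⊥-elim (ℕP.<⇒≱ n<t t≤n)
      ; lowers-first = λ x _ _ → x≡x-a+a x A
      ; lowers       = λ _ _ n<t t≤n _ _ → ⊥-elim (ℕP.<⇒≱ n<t t≤n)
      ; fixes-above  = λ _ _ → refl
      }
      where
      x≡x-a+a : ∀ x a → x ≡ x - a + a
      x≡x-a+a = solve-∀

    module Step (m c : ℕ) (m+c≡n : suc m ℕ.+ c ≡ n) (ih : Invariant (suc m) c) where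
      private
        module IH = Invariant ih
        a b g : ℤ
        a = α (suc m)
        b = α (suc (suc m))
        g = γ (suc m)

      sm≤n : suc m ℕ.≤ n
      sm≤n = ℕP.≤-trans (ℕP.m≤m+n (suc m) c) (ℕP.≤-reflexive m+c≡n)

      a≤b : a ≤ b
      a≤b = α-increasing (suc m) (s≤s sm≤n)

      a≤g : a ≤ g
      a≤g = α≤γ (ℕP.m≤n⇒m≤1+n sm≤n)

      α-mono : ∀ {s t} → s ℕ.≤ t → t ℕ.≤ suc n → α s ≤ α t
      α-mono = increasing⇒monotone α-increasing

      gap-mono : ∀ {s t} → s ℕ.≤ t → t ℕ.≤ suc n → gap s ≤ gap t
      gap-mono = increasing⇒monotone gap-increasing

      above-row : ∀ {y u v} → b ≤ u → gap (suc m) ≤ v → u + v < y → b + g - a < y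
      above-row {y} {u} {v} b≤u gap≤v u+v<y =
        <-via-difference ((y - (u + v)) + (u - b) + (v - gap (suc m))) (regroup y u v b g a)
          (+-mono-<-≤ (+-mono-<-≤ (i<j⇒0<j-i u+v<y) (i≤j⇒0≤j-i b≤u)) (i≤j⇒0≤j-i gap≤v))
        where
        regroup : ∀ y u v b g a → y - (b + g - a) ≡ (y - (u + v)) + (u - b) + (v - (g - a))
        regroup = solve-∀

      fixes-below : ∀ x → x ≤ a → exchange a b g (exchanges α γ (suc m) c x) ≡ x
      fixes-below x x≤a rewrite IH.fixes-below x (≤-trans x≤a a≤b) = exchange-below a b g a≤b x≤a

      raises : ∀ t x → m ℕ.< t → t ℕ.≤ n → α t < x → x ≤ α (suc t) →
               exchange a b g (exchanges α γ (suc m) c x) ≡ x + gap t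
      raises t x m<t t≤n αt<x x≤αt′ with ℕP.m≤n⇒m<n∨m≡n m<t
      ... | inj₂ refl rewrite IH.fixes-below x x≤αt′ =
        trans (exchange-lower a b g αt<x x≤αt′) (+-assoc x g (- a))
      ... | inj₁ sm<t rewrite IH.raises t x sm<t t≤n αt<x x≤αt′ =
        exchange-above a b g a≤g (above-row (α-mono sm<t (ℕP.m≤n⇒m≤1+n t≤n))
                                      (gap-mono (ℕP.<⇒≤ sm<t) (ℕP.m≤n⇒m≤1+n t≤n))
                                      (+-monoˡ-< (gap t) αt<x))

      lowers-first : ∀ x → A < x → x ≤ A + gap (suc m) →
                     exchange a b g (exchanges α γ (suc m) c x) ≡ x - A + a
      lowers-first x A<x x≤ rewrite IH.lowers-first x A<x (≤-trans x≤ (+-monoʳ-≤ A (gap-increasing (suc m) (s≤s sm≤n)))) =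
        trans (exchange-upper a b g (<-via-difference (x - A) (e₁ x A b) (i<j⇒0<j-i A<x))
                              (≤-via-difference (A + (g - a) - x) (e₂ x A b g a) (i≤j⇒0≤j-i x≤)))
              (e₃ x A b a)
        where
        e₁ : ∀ x A b → x - A + b - b ≡ x - A
        e₁ = solve-∀
        e₂ : ∀ x A b g a → b + g - a - (x - A + b) ≡ A + (g - a) - x
        e₂ = solve-∀
        e₃ : ∀ x A b a → x - A + b - b + a ≡ x - A + a
        e₃ = solve-∀

      lowers : ∀ t x → m ℕ.< t → t ℕ.≤ n → A + gap t < x → x ≤ A + gap (suc t) →
               exchange a b g (exchanges α γ (suc m) c x) ≡ x - A + α (suc t)
      lowers t x m<t t≤n A+gap<x x≤ with ℕP.m≤n⇒m<n∨m≡n m<t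
      ... | inj₂ refl rewrite IH.lowers-first x (≤-<-trans (A≤A+gap (ℕP.m≤n⇒m≤1+n t≤n)) A+gap<x) x≤ =
        exchange-above a b g a≤g (above-row ≤-refl ≤-refl (<-via-difference (x - (A + gap t)) (e₁ x A b (gap t)) (i<j⇒0<j-i A+gap<x)))
        where
        e₁ : ∀ x A b d → x - A + b - (b + d) ≡ x - (A + d)
        e₁ = solve-∀
      ... | inj₁ sm<t rewrite IH.lowers t x sm<t t≤n A+gap<x x≤ =
        exchange-above a b g a≤g (above-row (α-mono (ℕP.<⇒≤ (s≤s sm<t)) (s≤s t≤n))
                                      (gap-mono (ℕP.<⇒≤ sm<t) (ℕP.m≤n⇒m≤1+n t≤n))
                                      (<-via-difference (x - (A + gap t)) (e₁ x A (α (suc t)) (gap t)) (i<j⇒0<j-i A+gap<x)))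
        where
        e₁ : ∀ x A b d → x - A + b - (b + d) ≡ x - (A + d)
        e₁ = solve-∀

      fixes-above : ∀ x → A + gap (suc n) < x → exchange a b g (exchanges α γ (suc m) c x) ≡ x
      fixes-above x top<x rewrite IH.fixes-above x top<x =
        exchange-above a b g a≤g (above-row (α-mono (s≤s sm≤n) ℕP.≤-refl) (gap-mono (ℕP.m≤n⇒m≤1+n sm≤n) ℕP.≤-refl) top<x)

    invariant-step : ∀ m c → suc m ℕ.+ c ≡ n → Invariant (suc m) c → Invariant m (suc c)
    invariant-step m c m+c≡n ih = record
      { fixes-below = fixes-below ; raises = raises ; lowers-first = lowers-first
      ; lowers = lowers ; fixes-above = fixes-above }
      where open Step m c m+c≡n ih

    invariant : ∀ c m → m ℕ.+ c ≡ n → Invariant m c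
    invariant zero    m m+0≡n rewrite ℕP.+-identityʳ m | m+0≡n = invariant-start
    invariant (suc c) m m+c≡n = invariant-step m c m+c≡n′ (invariant c (suc m) m+c≡n′)
      where
      m+c≡n′ : suc m ℕ.+ c ≡ n
      m+c≡n′ = trans (sym (ℕP.+-suc m c)) m+c≡n

    block : ℤ → ℤ
    block = exchanges α γ 0 n

    private
      module Whole = Invariant (invariant n 0 refl)

    block-raises : ∀ {t x} → t ℕ.≤ n → α t < x → x ≤ α (suc t) → block x ≡ x + gap t
    block-raises {zero}  {x} _   _    x≤α₁ = trans (Whole.fixes-below x x≤α₁) (sym (trans (cong (λ d → x + d) gap-zero) (+-identityʳ x)))
    block-raises {suc t} {x} t≤n α<x x≤α = Whole.raises (suc t) x (s≤s z≤n) t≤n α<x x≤α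

    block-lowers : ∀ {t x} → t ℕ.≤ n → A + gap t < x → x ≤ A + gap (suc t) → block x ≡ x - A + α (suc t)
    block-lowers {zero}  {x} _   A<x x≤ = Whole.lowers-first x (subst (_< x) (trans (cong (λ d → A + d) gap-zero) (+-identityʳ A)) A<x) x≤
    block-lowers {suc t} {x} t≤n A<x x≤ = Whole.lowers (suc t) x (s≤s z≤n) t≤n A<x x≤

    block-fixes-above : ∀ {x} → A + gap (suc n) < x → block x ≡ x
    block-fixes-above {x} = Whole.fixes-above x

sumUpTo : (ℕ → ℕ) → ℕ → ℕ
sumUpTo f c = sum (map f (upTo c))

sumUpTo-suc : ∀ f c → sumUpTo f (suc c) ≡ f 0 ℕ.+ sumUpTo (f ∘ suc) c
sumUpTo-suc f c = cong (f 0 ℕ.+_) (cong sum (trans (map-applyUpTo suc f c) (sym (map-upTo (f ∘ suc) c))))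

sumUpTo-suc-last : ∀ f c → sumUpTo f (suc c) ≡ sumUpTo f c ℕ.+ f c
sumUpTo-suc-last f c = begin
  sum (map f (upTo (suc c)))         ≡⟨ cong (sum ∘ map f) (upTo-∷ʳ c) ⟨
  sum (map f (upTo c ++ c ∷ []))     ≡⟨ cong sum (map-++ f (upTo c) (c ∷ [])) ⟩
  sum (map f (upTo c) ++ f c ∷ [])   ≡⟨ sum-++ (map f (upTo c)) (f c ∷ []) ⟩
  sumUpTo f c ℕ.+ (f c ℕ.+ 0)        ≡⟨ cong (sumUpTo f c ℕ.+_) (ℕP.+-identityʳ (f c)) ⟩
  sumUpTo f c ℕ.+ f c                ∎
  where open ≡-Reasoning

sumUpTo-cong : ∀ {f g} c → (∀ t → f t ≡ g t) → sumUpTo f c ≡ sumUpTo g c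
sumUpTo-cong c f≗g = cong sum (map-cong f≗g (upTo c))

module RankFamily (n : ℕ) (r : ℕ → ℕ → ℕ) (rc : RankConditions n r) where
  open import Data.Integer using (_≤_; _<_)
  open Sequences

  e : ℕ → ℕ
  e = dimVec n r

  e-≤ : ∀ {k} → k ℕ.≤ n → e k ≡ r k k
  e-≤ {k} k≤n with k ℕ.≤? n
  ... | yes _   = refl
  ... | no  k≰n = ⊥-elim (k≰n k≤n)

  e-> : ∀ {k} → n ℕ.< k → e k ≡ 0
  e-> {k} n<k with k ℕ.≤? n
  ... | yes k≤n = ⊥-elim (ℕP.<⇒≱ n<k k≤n)
  ... | no  _   = refl

  sumE-diag : ∀ a → sumE n r a a ≡ e a
  sumE-diag a rewrite ℕP.n∸n≡0 a = trans (ℕP.+-identityʳ _) (cong e (ℕP.+-identityʳ a))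

  sumE-suc-last : ∀ {a b} → a ℕ.≤ b → sumE n r a (suc b) ≡ sumE n r a b ℕ.+ e (suc b)
  sumE-suc-last {a} {b} a≤b rewrite ℕP.+-∸-assoc 1 a≤b =
    trans (sumUpTo-suc-last (λ t → e (a ℕ.+ t)) (suc (b ∸ a)))
          (cong (λ k → sumE n r a b ℕ.+ e k) (trans (ℕP.+-suc a (b ∸ a)) (cong suc (ℕP.m+[n∸m]≡n a≤b))))

  sumE-suc-first : ∀ {a b} → a ℕ.< b → sumE n r a b ≡ e a ℕ.+ sumE n r (suc a) b
  sumE-suc-first {a} {b} a<b = begin
    sumUpTo (λ t → e (a ℕ.+ t)) (suc (b ∸ a))
      ≡⟨ cong (λ k → sumUpTo (λ t → e (a ℕ.+ t)) (suc k)) (ℕP.+-∸-assoc 1 a<b) ⟩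
    sumUpTo (λ t → e (a ℕ.+ t)) (suc (suc (b ∸ suc a)))
      ≡⟨ sumUpTo-suc (λ t → e (a ℕ.+ t)) (suc (b ∸ suc a)) ⟩
    e (a ℕ.+ 0) ℕ.+ sumUpTo (λ t → e (a ℕ.+ suc t)) (suc (b ∸ suc a))
      ≡⟨ cong₂ ℕ._+_ (cong e (ℕP.+-identityʳ a)) (sumUpTo-cong (suc (b ∸ suc a)) (λ t → cong e (ℕP.+-suc a t))) ⟩
    e a ℕ.+ sumE n r (suc a) b ∎
    where open ≡-Reasoning

  rx-upper : ∀ {i j} → j ℕ.≤ n → i ℕ.≤ j → rx n r (+ i) (+ j) ≡ + r i j
  rx-upper {i} {j} j≤n i≤j with j ℕ.≤? n | i ℕ.≤? j
  ... | yes _   | yes _   = refl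
  ... | no  j≰n | _       = ⊥-elim (j≰n j≤n)
  ... | yes _   | no  i≰j = ⊥-elim (i≰j i≤j)

  rx-lower : ∀ {i j} → j ℕ.≤ n → j ℕ.≤ i → rx n r (+ i) (+ j) ≡ + sumE n r j i
  rx-lower {i} {j} j≤n j≤i with j ℕ.≤? n | i ℕ.≤? j
  ... | no  j≰n | _       = ⊥-elim (j≰n j≤n)
  ... | yes _   | no  _   = refl
  ... | yes _   | yes i≤j with ℕP.≤-antisym i≤j j≤i
  ...   | refl = cong +_ (trans (sym (e-≤ j≤n)) (sym (sumE-diag i)))

  rx-beyond : ∀ {i j} → n ℕ.< j → rx n r (+ i) (+ j) ≡ 0ℤ
  rx-beyond {i} {j} n<j with j ℕ.≤? n
  ... | yes j≤n = ⊥-elim (ℕP.<⇒≱ n<j j≤n)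
  ... | no  _   = refl

  rx-nonneg : ∀ i j → 0ℤ ≤ rx n r (+ i) (+ j)
  rx-nonneg i j with j ℕ.≤? n | i ℕ.≤? j
  ... | yes _ | yes _ = ℤ.+≤+ z≤n
  ... | yes _ | no  _ = ℤ.+≤+ z≤n
  ... | no  _ | _     = ℤ.+≤+ z≤n

  ρ : ℕ → ℕ → ℤ
  ρ t j = rx n r (+ t - 1ℤ) (+ j)

  jump : ℕ → ℕ → ℤ
  jump t j = ρ t j - ρ t (suc j)

  ρ-beyond : ∀ t → ρ t (suc n) ≡ 0ℤ
  ρ-beyond zero    = refl
  ρ-beyond (suc t) = rx-beyond ℕP.≤-refl

  ρ-increasing : ∀ j → IncreasingBelow (λ t → ρ t j) (suc n)
  ρ-increasing j zero    _ = rx-nonneg 0 j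
  ρ-increasing j (suc i) (s≤s i<n) with ℕP.≤-<-connex j n
  ... | inj₂ n<j rewrite rx-beyond {i} n<j | rx-beyond {suc i} n<j = ≤-refl
  ... | inj₁ j≤n with ℕP.<-cmp i j
  ...   | tri< i<j _ _ rewrite rx-upper j≤n (ℕP.<⇒≤ i<j) | rx-upper j≤n i<j =
          ℤ.+≤+ (proj₂ (proj₁ rc i j i<j j≤n))
  ...   | tri≈ _ refl _ rewrite rx-lower {i} j≤n ℕP.≤-refl | rx-lower {suc i} j≤n (ℕP.n≤1+n i)
                              | sumE-suc-last {i} ℕP.≤-refl = ℤ.+≤+ (ℕP.m≤m+n _ _)
  ...   | tri> _ _ j<i rewrite rx-lower {i} j≤n (ℕP.<⇒≤ j<i) | rx-lower {suc i} j≤n (ℕP.m≤n⇒m≤1+n (ℕP.<⇒≤ j<i))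
                              | sumE-suc-last (ℕP.<⇒≤ j<i) = ℤ.+≤+ (ℕP.m≤m+n _ _)

  jump-increasing : ∀ {j} → j ℕ.≤ n → IncreasingBelow (λ t → jump t j) (suc n)
  jump-increasing {j} j≤n zero _ with ℕP.m≤n⇒m<n∨m≡n j≤n
  ... | inj₂ refl rewrite ρ-beyond 1 = i≤j⇒0≤j-i (rx-nonneg 0 n)
  ... | inj₁ j<n rewrite rx-upper {0} j≤n z≤n | rx-upper {0} j<n z≤n =
    i≤j⇒0≤j-i (ℤ.+≤+ (proj₁ (proj₁ rc 0 (suc j) (s≤s z≤n) j<n)))
  jump-increasing {j} j≤n (suc i) (s≤s i<n) with ℕP.m≤n⇒m<n∨m≡n j≤n
  ... | inj₂ refl rewrite ρ-beyond (suc i) | ρ-beyond (suc (suc i)) =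
    +-monoˡ-≤ (- 0ℤ) (ρ-increasing n (suc i) (s≤s i<n))
  ... | inj₁ j<n with ℕP.<-cmp i j
  ...   | tri< i<j _ _ rewrite rx-upper j≤n (ℕP.<⇒≤ i<j) | rx-upper j<n (ℕP.m≤n⇒m≤1+n (ℕP.<⇒≤ i<j))
                            | rx-upper j≤n i<j | rx-upper j<n (s≤s (ℕP.<⇒≤ i<j)) =
    ≤-via-difference _ (regroup (+ r i j) (+ r i (suc j)) (+ r (suc i) j) (+ r (suc i) (suc j)))
                     (i≤j⇒0≤j-i (ℤ.+≤+ (proj₂ rc (suc i) j (s≤s z≤n) i<j j<n)))
    where
    regroup : ∀ a b c d → (c - d) - (a - b) ≡ (c + b) - (a + d)
    regroup = solve-∀
  ...   | tri≈ _ refl _ rewrite rx-upper {i} j≤n ℕP.≤-refl | rx-upper j<n (ℕP.n≤1+n i)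
                            | rx-lower {suc i} j≤n (ℕP.n≤1+n i) | rx-upper {suc i} j<n ℕP.≤-refl
                            | sumE-suc-last {i} ℕP.≤-refl | sumE-diag i | e-≤ j≤n | e-≤ j<n =
    ≤-via-difference (+ r i (suc i)) (regroup (+ r i i) (+ r i (suc i)) (+ r (suc i) (suc i))) (ℤ.+≤+ z≤n)
    where
    regroup : ∀ a b c → (a + c - c) - (a - b) ≡ b
    regroup = solve-∀
  ...   | tri> _ _ j<i rewrite rx-lower j≤n (ℕP.<⇒≤ j<i) | rx-lower j<n j<i
                            | rx-lower {suc i} j≤n (ℕP.m≤n⇒m≤1+n (ℕP.<⇒≤ j<i))
                            | rx-lower {suc i} j<n (ℕP.m≤n⇒m≤1+n j<i)
                            | sumE-suc-first j<i | sumE-suc-first (ℕP.m≤n⇒m≤1+n j<i) =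
    ≤-reflexive (trans (cancel (+ e j) (+ sumE n r (suc j) i)) (sym (cancel (+ e j) (+ sumE n r (suc j) (suc i)))))
    where
    cancel : ∀ a b → a + b - b ≡ a
    cancel = solve-∀

  jump-nonneg : ∀ {t j} → j ℕ.≤ n → t ℕ.≤ suc n → 0ℤ ≤ jump t j
  jump-nonneg j≤n = increasing⇒monotone (jump-increasing j≤n) z≤n

  ρ-top-decreasing : DecreasingBelow (ρ (suc n)) (suc n)
  ρ-top-decreasing t t<n+1 = 0≤i-j⇒j≤i (jump-nonneg (ℕP.≤-pred t<n+1) ℕP.≤-refl)

  row-step-decreasing : ∀ {i} → i ℕ.≤ n → DecreasingBelow (λ j → ρ (suc i) j - ρ i j) n
  row-step-decreasing {i} i≤n t t<n =
    ≤-via-difference _ (regroup (ρ i t) (ρ i (suc t)) (ρ (suc i) t) (ρ (suc i) (suc t)))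
                     (i≤j⇒0≤j-i (jump-increasing (ℕP.<⇒≤ t<n) i (s≤s i≤n)))
    where
    regroup : ∀ a b c d → (c - a) - (d - b) ≡ (c - d) - (a - b)
    regroup = solve-∀

  cut : ℕ → ℕ → ℤ
  cut i j = ρ (suc n) (suc j) + ρ i j - ρ i (suc j)

  InCell : ℤ → ℕ → ℕ → Set
  InCell p i j = cut i j < p × p ≤ cut (suc i) j

  cut-jump : ∀ i j → cut i j ≡ ρ (suc n) (suc j) + jump i j
  cut-jump i j = +-assoc (ρ (suc n) (suc j)) (ρ i j) (- ρ i (suc j))

  cut-zero : ∀ j → cut 0 j ≡ ρ (suc n) (suc j)
  cut-zero j = x+0-0≡x (ρ (suc n) (suc j))
    where
    x+0-0≡x : ∀ x → x + 0ℤ - 0ℤ ≡ x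
    x+0-0≡x = solve-∀

  cut-top : ∀ {j} → j ℕ.≤ n → cut (suc (suc j)) j ≡ ρ (suc n) j
  cut-top {j} j≤n with ℕP.m≤n⇒m<n∨m≡n j≤n
  ... | inj₁ j<n rewrite rx-lower {n} j<n j<n | rx-lower {suc j} j≤n (ℕP.n≤1+n j)
                       | rx-lower {suc j} j<n ℕP.≤-refl | rx-lower {n} j≤n j≤n
                       | sumE-suc-first {j} ℕP.≤-refl | sumE-suc-first j<n =
    regroup (+ sumE n r (suc j) n) (+ e j) (+ sumE n r (suc j) (suc j))
    where
    regroup : ∀ a b c → a + (b + c) - c ≡ b + a
    regroup = solve-∀
  ... | inj₂ refl rewrite ρ-beyond (suc n) | ρ-beyond (suc (suc n))
                        | rx-lower {suc n} {n} ℕP.≤-refl (ℕP.n≤1+n n) | rx-lower {n} {n} ℕP.≤-refl ℕP.≤-refl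
                        | sumE-suc-last {n} ℕP.≤-refl | e-> {suc n} ℕP.≤-refl | ℕP.+-identityʳ (sumE n r n n) =
    x+0-0≡x (+ sumE n r n n)
    where
    x+0-0≡x : ∀ x → 0ℤ + x - 0ℤ ≡ x
    x+0-0≡x = solve-∀

  last-cell-empty : cut (suc (suc n)) n ≡ cut (suc n) n
  last-cell-empty = trans (cut-top ℕP.≤-refl) (sym (cancel (ρ (suc n) (suc n)) (ρ (suc n) n)))
    where
    cancel : ∀ a b → a + b - a ≡ b
    cancel = solve-∀

  cut-increasing : ∀ {j} → j ℕ.≤ n → IncreasingBelow (λ t → cut t j) (suc n)
  cut-increasing {j} j≤n t t<n+1 =
    subst₂ _≤_ (sym (cut-jump t j)) (sym (cut-jump (suc t) j))
               (+-monoʳ-≤ (ρ (suc n) (suc j)) (jump-increasing j≤n t t<n+1))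

  cut-increasing-to-top : ∀ {j} → j ℕ.≤ n → IncreasingBelow (λ t → cut t j) (suc (suc j))
  cut-increasing-to-top {j} j≤n t t<j+2 with ℕP.m≤n⇒m<n∨m≡n (ℕP.≤-trans (ℕP.≤-pred t<j+2) (s≤s j≤n))
  ... | inj₁ t<n+1 = cut-increasing j≤n t t<n+1
  ... | inj₂ refl with ℕP.≤-antisym j≤n (ℕP.≤-pred (ℕP.≤-pred t<j+2))
  ...   | refl = ≤-reflexive (sym last-cell-empty)

module Columns (n : ℕ) (r : ℕ → ℕ → ℕ) (rc : RankConditions n r) where
  open import Data.Integer using (_≤_; _<_)
  open Sequences
  open Exchanges
  open RankFamily n r rc

  column : ℕ → ℤ → ℤ
  column k = exchanges (λ t → ρ t k) (λ t → ρ t (k ∸ 1)) 0 n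

  columns : ℕ → ℕ → ℤ → ℤ
  columns κ zero    x = x
  columns κ (suc c) x = column (suc κ) (columns (suc κ) c x)

  row : ℕ → List (ℕ × ℕ)
  row k = map (λ i → (i , k)) (upTo n)

  -- The step function of zperm is a pattern-matching lambda, which cannot be restated up to
  -- definitional equality, so the fold is analysed for any F agreeing with it.
  module Fold (F : ℕ × ℕ → (ℤ → ℤ) → ℤ → ℤ) (F≗W : ∀ i j g x → F (i , j) g x ≡ W n r i j (g x)) where
    foldr-init : ∀ xs g x → foldr F g xs x ≡ foldr F id xs (g x)
    foldr-init []             g x = refl
    foldr-init ((i , j) ∷ xs) g x =
      trans (F≗W i j _ x) (trans (cong (W n r i j) (foldr-init xs g x)) (sym (F≗W i j _ (g x))))

    foldr-F-++ : ∀ xs ys x → foldr F id (xs ++ ys) x ≡ foldr F id xs (foldr F id ys x)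
    foldr-F-++ xs ys x = trans (cong (λ f → f x) (foldr-++ F id xs ys)) (foldr-init xs (foldr F id ys) x)

    foldr-row : ∀ k f m c → (∀ i → f i ≡ m ℕ.+ i) → ∀ x →
                foldr F id (map (λ i → (i , k)) (applyUpTo f c)) x ≡ exchanges (λ t → ρ t k) (λ t → ρ t (k ∸ 1)) m c x
    foldr-row k f m zero    f≗m+ x = refl
    foldr-row k f m (suc c) f≗m+ x =
      trans (F≗W (f 0) k _ x)
            (cong₂ (λ i y → W n r i k y) (trans (f≗m+ 0) (ℕP.+-identityʳ m))
                   (foldr-row k (f ∘ suc) (suc m) c (λ i → trans (f≗m+ (suc i)) (ℕP.+-suc m i)) x))

    foldr-columns : ∀ κ g c → (∀ i → g i ≡ suc κ ℕ.+ i) → ∀ x →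
                    foldr F id (concat (map row (applyUpTo g c))) x ≡ columns κ c x
    foldr-columns κ g zero    g≗ x = refl
    foldr-columns κ g (suc c) g≗ x = begin
      foldr F id (row (g 0) ++ concat (map row (applyUpTo (g ∘ suc) c))) x
        ≡⟨ foldr-F-++ (row (g 0)) _ x ⟩
      foldr F id (row (g 0)) (foldr F id (concat (map row (applyUpTo (g ∘ suc) c))) x)
        ≡⟨ cong₂ (λ k y → foldr F id (row k) y) (trans (g≗ 0) (ℕP.+-identityʳ (suc κ)))
                 (foldr-columns (suc κ) (g ∘ suc) c (λ i → trans (g≗ (suc i)) (ℕP.+-suc (suc κ) i)) x) ⟩
      foldr F id (row (suc κ)) (columns (suc κ) c x)
        ≡⟨ foldr-row (suc κ) id 0 n (λ _ → refl) (columns (suc κ) c x) ⟩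
      columns κ (suc c) x ∎
      where open ≡-Reasoning

    foldr-zIndices : ∀ x → foldr F id (zIndices n) x ≡ columns 0 n x
    foldr-zIndices x = trans (cong (λ ks → foldr F id (concat (map row ks)) x) (map-upTo suc n))
                             (foldr-columns 0 suc n (λ _ → refl) x)

  zperm≡columns : ∀ x → zperm n r x ≡ columns 0 n x
  zperm≡columns = Fold.foldr-zIndices _ (λ _ _ _ _ → refl)

  module ColumnBlock (κ : ℕ) (κ<n : κ ℕ.< n) =
    Block n (λ t → ρ t (suc κ)) (λ t → ρ t κ) (ρ-increasing (suc κ)) (jump-increasing (ℕP.<⇒≤ κ<n)) refl

  κ+suc[c]≡n⇒suc[κ]+c≡n : ∀ {κ c} → κ ℕ.+ suc c ≡ n → suc κ ℕ.+ c ≡ n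
  κ+suc[c]≡n⇒suc[κ]+c≡n {κ} {c} eq = trans (sym (ℕP.+-suc κ c)) eq

  κ+suc[c]≡n⇒κ<n : ∀ {κ c} → κ ℕ.+ suc c ≡ n → κ ℕ.< n
  κ+suc[c]≡n⇒κ<n {κ} {c} eq = ℕP.≤-trans (ℕP.m≤m+n (suc κ) c) (ℕP.≤-reflexive (κ+suc[c]≡n⇒suc[κ]+c≡n eq))

  columns-fix : ∀ {p} c κ → κ ℕ.+ c ≡ n → ρ (suc n) κ < p → columns κ c p ≡ p
  columns-fix     zero    κ _     _    = refl
  columns-fix {p} (suc c) κ κ+c≡n ρκ<p =
    trans (cong (column (suc κ)) (columns-fix c (suc κ) (κ+suc[c]≡n⇒suc[κ]+c≡n κ+c≡n) ρκ′<p))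
          (ColumnBlock.block-fixes-above κ κ<n (subst (_< p) (sym (a+[b-a]≡b (ρ (suc n) (suc κ)) (ρ (suc n) κ))) ρκ<p))
    where
    κ<n : κ ℕ.< n
    κ<n = κ+suc[c]≡n⇒κ<n κ+c≡n
    ρκ′<p : ρ (suc n) (suc κ) < p
    ρκ′<p = ≤-<-trans (ρ-top-decreasing κ (ℕP.m≤n⇒m≤1+n κ<n)) ρκ<p
    a+[b-a]≡b : ∀ a b → a + (b - a) ≡ b
    a+[b-a]≡b = solve-∀

  cellImage : ℤ → ℕ → ℕ → ℕ → ℤ
  cellImage p i j κ = p - ρ (suc n) (suc j) + ρ (suc i) (suc j) + ρ i κ - ρ i j

  module _ {p i j} (i≤n : i ℕ.≤ n) (j≤n : j ℕ.≤ n) (cell : InCell p i j) where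

    ρ-top<cell : ρ (suc n) (suc j) < p
    ρ-top<cell = ≤-<-trans (subst (_≤ cut i j) (cut-zero j)
                                  (increasing⇒monotone (cut-increasing j≤n) z≤n (ℕP.m≤n⇒m≤1+n i≤n)))
                           (proj₁ cell)

    enters-column : j ℕ.< n → column (suc j) p ≡ cellImage p i j j
    enters-column j<n =
      trans (ColumnBlock.block-lowers j j<n i≤n (subst (_< p) (cut-jump i j) (proj₁ cell))
                                                (subst (p ≤_) (cut-jump (suc i) j) (proj₂ cell)))
            (add-cancel p (ρ (suc n) (suc j)) (ρ (suc i) (suc j)) (ρ i j))
      where
      add-cancel : ∀ p A B a → p - A + B ≡ p - A + B + a - a
      add-cancel = solve-∀

    shifts-column : ∀ {κ} → κ ℕ.< j → column (suc κ) (cellImage p i j (suc κ)) ≡ cellImage p i j κ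
    shifts-column {κ} κ<j =
      trans (ColumnBlock.block-raises κ (ℕP.<-≤-trans κ<j j≤n) i≤n ρ<q q≤ρ)
            (telescope p N R (ρ i (suc κ)) (ρ i j) (ρ i κ))
      where
      N R q : ℤ
      N = ρ (suc n) (suc j)
      R = ρ (suc i) (suc j)
      q = cellImage p i j (suc κ)
      telescope : ∀ p N R a b c → p - N + R + a - b + (c - a) ≡ p - N + R + c - b
      telescope = solve-∀
      ρ<q : ρ i (suc κ) < q
      ρ<q = <-via-difference ((p - cut i j) + (R - ρ i (suc j))) (regroup p N R (ρ i (suc κ)) (ρ i j) (ρ i (suc j)))
                             (+-mono-<-≤ (i<j⇒0<j-i (proj₁ cell)) (i≤j⇒0≤j-i (ρ-increasing (suc j) i (s≤s i≤n))))
        where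
        regroup : ∀ p N R a b d → p - N + R + a - b - a ≡ (p - (N + b - d)) + (R - d)
        regroup = solve-∀
      q≤ρ : q ≤ ρ (suc i) (suc κ)
      q≤ρ = ≤-via-difference ((cut (suc i) j - p) + ((ρ (suc i) (suc κ) - ρ i (suc κ)) - (ρ (suc i) j - ρ i j)))
                             (regroup p N R (ρ i (suc κ)) (ρ i j) (ρ (suc i) (suc κ)) (ρ (suc i) j))
                             (+-mono-≤ (i≤j⇒0≤j-i (proj₂ cell))
                                       (i≤j⇒0≤j-i (decreasing⇒antitone (row-step-decreasing i≤n) κ<j j≤n)))
        where
        regroup : ∀ p N R a b s t → s - (p - N + R + a - b) ≡ ((N + t - R) - p) + ((s - a) - (t - b))
        regroup = solve-∀

    columns-cell : ∀ c κ → κ ℕ.+ c ≡ n → κ ℕ.≤ j → columns κ c p ≡ cellImage p i j κ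
    columns-cell zero κ κ+0≡n κ≤j with trans (sym (ℕP.+-identityʳ κ)) κ+0≡n
    ... | refl with ℕP.≤-antisym j≤n κ≤j
    ...   | refl rewrite ρ-beyond (suc n) | ρ-beyond (suc i) = add-cancel p (ρ i n)
      where
      add-cancel : ∀ p a → p ≡ p - 0ℤ + 0ℤ + a - a
      add-cancel = solve-∀
    columns-cell (suc c) κ κ+c≡n κ≤j with ℕP.m≤n⇒m<n∨m≡n κ≤j
    ... | inj₂ refl = trans (cong (column (suc j)) (columns-fix c (suc j) (κ+suc[c]≡n⇒suc[κ]+c≡n κ+c≡n) ρ-top<cell))
                            (enters-column (κ+suc[c]≡n⇒κ<n κ+c≡n))
    ... | inj₁ κ<j  = trans (cong (column (suc κ)) (columns-cell c (suc κ) (κ+suc[c]≡n⇒suc[κ]+c≡n κ+c≡n) κ<j))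
                            (shifts-column κ<j)

  zperm-on-cell : ∀ {p i j} → i ℕ.≤ n → j ℕ.≤ n → InCell p i j → zperm n r p ≡ cellImage p i j 0
  zperm-on-cell i≤n j≤n cell = trans (zperm≡columns _) (columns-cell i≤n j≤n cell n 0 refl z≤n)

module Cells (n : ℕ) (r : ℕ → ℕ → ℕ) (rc : RankConditions n r) where
  open import Data.Integer using (_≤_; _<_)
  open Sequences
  open RankFamily n r rc
  open Columns n r rc

  cell⇒column-crossing : ∀ {p a b} → a ℕ.≤ suc b → b ℕ.≤ n → InCell p a b →
                         ρ (suc n) (suc b) < p × p ≤ ρ (suc n) b
  cell⇒column-crossing {p} {a} {b} a≤b+1 b≤n (cut<p , p≤cut) =
    ≤-<-trans (subst (_≤ cut a b) (cut-zero b) (cut-mono z≤n (ℕP.m≤n⇒m≤1+n a≤b+1))) cut<p ,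
    ≤-trans p≤cut (subst (cut (suc a) b ≤_) (cut-top b≤n) (cut-mono (s≤s a≤b+1) ℕP.≤-refl))
    where
    cut-mono : ∀ {s t} → s ℕ.≤ t → t ℕ.≤ suc (suc b) → cut s b ≤ cut t b
    cut-mono = increasing⇒monotone (cut-increasing-to-top b≤n)

  cell-row≤n : ∀ {p i j} → i ℕ.≤ suc j → j ℕ.≤ n → InCell p i j → i ℕ.≤ n
  cell-row≤n {p} {i} {j} i≤j+1 j≤n (cut<p , p≤cut) with i ℕ.≤? n
  ... | yes i≤n = i≤n
  ... | no  i≰n with ℕP.≤-antisym (ℕP.≤-trans i≤j+1 (s≤s j≤n)) (ℕP.≰⇒> i≰n)
  ...   | refl with ℕP.≤-antisym j≤n (ℕP.≤-pred (ℕP.≤-trans (ℕP.≰⇒> i≰n) i≤j+1))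
  ...     | refl = ⊥-elim (<⇒≱ cut<p (≤-trans p≤cut (≤-reflexive last-cell-empty)))

  cell-exists : ∀ {p} → 0ℤ < p → p ≤ ρ (suc n) 0 →
                Σ ℕ λ i → Σ ℕ λ j → i ℕ.≤ suc j × j ℕ.≤ n × InCell p i j
  cell-exists {p} 0<p p≤N
    with downward-crossing (ρ (suc n)) (suc n) (subst (_< p) (sym (ρ-beyond (suc n))) 0<p) p≤N
  ... | j , s≤s j≤n , ρ<p , p≤ρ
    with upward-crossing (λ t → cut t j) (suc (suc j)) (subst (_< p) (sym (cut-zero j)) ρ<p)
                         (subst (p ≤_) (sym (cut-top j≤n)) p≤ρ)
  ...   | i , s≤s i≤j+1 , cell = i , j , i≤j+1 , j≤n , cell

  cell-unique : ∀ {p a b i j} → a ℕ.≤ suc b → b ℕ.≤ n → InCell p a b →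
                i ℕ.≤ suc j → j ℕ.≤ n → InCell p i j → a ≡ i × b ≡ j
  cell-unique a≤b+1 b≤n cellᵃᵇ i≤j+1 j≤n cellⁱʲ
    with cell⇒column-crossing a≤b+1 b≤n cellᵃᵇ | cell⇒column-crossing i≤j+1 j≤n cellⁱʲ
  ... | ρ<p , p≤ρ | ρ<p′ , p≤ρ′
    with downward-crossing-unique ρ-top-decreasing (s≤s b≤n) (s≤s j≤n) ρ<p p≤ρ ρ<p′ p≤ρ′
  ...   | refl = upward-crossing-unique (cut-increasing-to-top j≤n) (s≤s a≤b+1) (s≤s i≤j+1)
                                        (proj₁ cellᵃᵇ) (proj₂ cellᵃᵇ) (proj₁ cellⁱʲ) (proj₂ cellⁱʲ) , refl

  -- IJCond writes the column index j + 1 as (+ j) ℤ.+ 1ℤ, which is + (j ℕ.+ 1) rather than + suc j.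
  cut≡ : ∀ a b → cut a b ≡ rx n r (+ n) (+ b + 1ℤ) + rx n r (+ a - 1ℤ) (+ b) - rx n r (+ a - 1ℤ) (+ b + 1ℤ)
  cut≡ a b = cong (λ y → rx n r (+ n) y + rx n r (+ a - 1ℤ) (+ b) - rx n r (+ a - 1ℤ) y) (cong +_ (ℕP.+-comm 1 b))

  cellImage≡ : ∀ p i j → cellImage p i j 0 ≡ p - rx n r (+ n) (+ j + 1ℤ) + rx n r (+ i) (+ j + 1ℤ)
                                                 + rx n r (+ i - 1ℤ) (+ 0) - rx n r (+ i - 1ℤ) (+ j)
  cellImage≡ p i j = cong (λ y → p - rx n r (+ n) y + rx n r (+ i) y + rx n r (+ i - 1ℤ) (+ 0) - rx n r (+ i - 1ℤ) (+ j))
                          (cong +_ (ℕP.+-comm 1 j))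

  cell⇒IJCond : ∀ {p i j} → i ℕ.≤ suc j → j ℕ.≤ n → InCell p i j → IJCond n r p (+ i) (+ j)
  cell⇒IJCond {p} {i} {j} i≤j+1 j≤n (cut<p , p≤cut) =
    ℤ.+≤+ z≤n , ℤ.+≤+ (subst (i ℕ.≤_) (ℕP.+-comm 1 j) i≤j+1) , ℤ.+≤+ (ℕP.+-monoˡ-≤ 1 j≤n) ,
    subst (_< p) (cut≡ i j) cut<p , subst (p ≤_) (cut≡ (suc i) j) p≤cut

  IJCond⇒cell : ∀ {p} i′ j′ → p ≤ ρ (suc n) 0 → IJCond n r p i′ j′ →
                Σ ℕ λ i → Σ ℕ λ j → i′ ≡ + i × j′ ≡ + j × i ℕ.≤ suc j × j ℕ.≤ n × InCell p i j
  IJCond⇒cell -[1+ _ ] _ _ (() , _)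
  IJCond⇒cell {p} (+ zero) -[1+ 0 ] p≤N (_ , _ , _ , N<p , _) =
    ⊥-elim (<⇒≱ (subst (_< p) (x+0-0≡x (ρ (suc n) 0)) N<p) p≤N)
    where
    x+0-0≡x : ∀ x → x + 0ℤ - 0ℤ ≡ x
    x+0-0≡x = solve-∀
  IJCond⇒cell (+ suc _) -[1+ 0 ] _ (_ , ℤ.+≤+ () , _)
  IJCond⇒cell (+ _) -[1+ suc _ ] _ (_ , () , _)
  IJCond⇒cell {p} (+ i) (+ j) _ (_ , ℤ.+≤+ i≤j+1 , ℤ.+≤+ j+1≤n+1 , lower , upper) =
    i , j , refl , refl , subst (i ℕ.≤_) (ℕP.+-comm j 1) i≤j+1 , ℕP.+-cancelʳ-≤ 1 j n j+1≤n+1 ,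
    subst (_< p) (sym (cut≡ i j)) lower , subst (p ≤_) (sym (cut≡ (suc i) j)) upper

  IJCond-unique : ∀ {p i j} → p ≤ ρ (suc n) 0 → i ℕ.≤ suc j → j ℕ.≤ n → InCell p i j →
                  ∀ i′ j′ → IJCond n r p i′ j′ → i′ ≡ + i × j′ ≡ + j
  IJCond-unique p≤N i≤j+1 j≤n cell i′ j′ cond with IJCond⇒cell i′ j′ p≤N cond
  ... | a , b , refl , refl , a≤b+1 , b≤n , cellᵃᵇ with cell-unique a≤b+1 b≤n cellᵃᵇ i≤j+1 j≤n cell
  ...   | refl , refl = refl , refl

open import Data.Nat using (_≤_)

lemma3p1 : (n : ℕ) → (r : ℕ → ℕ → ℕ) → 1 ≤ n → RankConditions n r →
    (p : ℤ) → 1ℤ ℤ.≤ p → p ℤ.≤ bigN n r →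
    Σ ℤ (λ i → Σ ℤ (λ j →
      (IJCond n r p i j ×
       zperm n r p ≡ p ℤ.- rx n r (+ n) (j ℤ.+ 1ℤ) ℤ.+ rx n r i (j ℤ.+ 1ℤ)
                       ℤ.+ rx n r (i ℤ.- 1ℤ) (+ 0) ℤ.- rx n r (i ℤ.- 1ℤ) j) ×
      ((i′ j′ : ℤ) → IJCond n r p i′ j′ → (i′ ≡ i) × (j′ ≡ j))))
lemma3p1 n r _ rc p 1≤p p≤N =
  let open Cells n r rc
      open Columns n r rc
      (i , j , i≤j+1 , j≤n , cell) = cell-exists (<-≤-trans (ℤ.+<+ (s≤s z≤n)) 1≤p) p≤N
  in + i , + j ,
     (cell⇒IJCond i≤j+1 j≤n cell ,
      trans (zperm-on-cell (cell-row≤n i≤j+1 j≤n cell) j≤n cell) (cellImage≡ p i j)) ,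
     IJCond-unique p≤N i≤j+1 j≤n cell
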